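{- Let $\Bbbk$ be a field and $W\subseteq\Bbbk^n$ a linear realization of the uniform matroid $U_{r,n}$, with ideal of pairs $\mathfrak a\subseteq S$. Then $g_{i_1}\cdots g_{i_r}f_a\in\mathfrak a$ for all $i_1,\dots,i_r,a\in[n]$ (not necessarily distinct). In other words, $\mathfrak p_{\emptyset,[n]}^{\,r}\cdot(f_1,\dots,f_n)\subseteq\mathfrak a$.
   Context: A linear realization of a rank-$r$ matroid on $[n]$ is an $r$-dimensional $W\subseteq\Bbbk^n$ such that $W\to\Bbbk^n\to\Bbbk^B$ (coordinate projection) is an isomorphism iff $B$ is a basis; for $U_{r,n}$ every $r$-subset is a basis. Identify $\Bbbk^n$ with its dual; $W^\perp=\{y:\sum x_iy_i=0\ \forall x\in W\}$. $f_i\in W^*$, $g_i\in(W^\perp)^*$ restrictions of the $i$-th coordinate function; $R=\Bbbk[W]$, $R^\perp=\Bbbk[W^\perp]$, $S=R\otimes_\Bbbk R^\perp$, $\mathfrak a=(f_1g_1,\dots,f_ng_n)$, $\mathfrak p_{\emptyset,[n]}=(g_1,\dots,g_n)\subseteq S$. -}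

module Defs where

open import Level using (Level; _⊔_) renaming (suc to lsuc)
open import Algebra.Bundles using (CommutativeRing)
open import Data.Nat as ℕ using (ℕ)
open import Data.Fin using (Fin; zero; suc)
open import Data.Fin.Properties using () renaming (_≟_ to _≟F_)
open import Data.Vec using (Vec; tabulate; replicate; zipWith)
open import Data.Vec.Properties using (≡-dec)
open import Data.List using (List; []; _∷_; map; concatMap; foldr)
open import Data.List.Relation.Unary.All using (All)
open import Data.Product using (Σ; _×_; _,_; ∃)
open import Data.Sum using (_⊎_)
open import Relation.Nullary using (¬_; yes; no)
open import Relation.Binary.PropositionalEquality using (_≡_)
open import Function.Definitions using (Injective)

record Field (c ℓ : Level) : Set (lsuc (c ⊔ ℓ)) where
  field
    commutativeRing : CommutativeRing c ℓ
  open CommutativeRing commutativeRing public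
  field
    1≉0 : ¬ (1# ≈ 0#)
    inverse : ∀ x → ¬ (x ≈ 0#) → Σ Carrier λ y → x * y ≈ 1#

module _ {c ℓ : Level} (F : Field c ℓ) where
  open Field F hiding (zero)

  sumF : ∀ {m} → (Fin m → Carrier) → Carrier
  sumF {ℕ.zero} v = 0#
  sumF {ℕ.suc m} v = v zero + sumF (λ i → v (suc i))

  -- standard bilinear form identifying k^n with its dual
  dot : ∀ {n} → (Fin n → Carrier) → (Fin n → Carrier) → Carrier
  dot x y = sumF (λ i → x i * y i)

  -- The subspace W ⊆ k^n is given by a basis w₁,…,w_r (rows of w).
  InSpan : ∀ {r n} → (Fin r → Fin n → Carrier) → (Fin n → Carrier) → Set (c ⊔ ℓ)
  InSpan {r} w x = Σ (Fin r → Carrier) λ t → ∀ i → x i ≈ sumF (λ j → t j * w j i)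

  LinIndep : ∀ {r n} → (Fin r → Fin n → Carrier) → Set (c ⊔ ℓ)
  LinIndep {r} w = ∀ (t : Fin r → Carrier) →
    (∀ i → sumF (λ j → t j * w j i) ≈ 0#) → ∀ j → t j ≈ 0#

  Perp : ∀ {r n} → (Fin r → Fin n → Carrier) → (Fin n → Carrier) → Set (c ⊔ ℓ)
  Perp w y = ∀ x → InSpan w x → dot x y ≈ 0#

  PerpPerp : ∀ {r n} → (Fin r → Fin n → Carrier) → (Fin n → Carrier) → Set (c ⊔ ℓ)
  PerpPerp w z = ∀ y → Perp w y → dot y z ≈ 0#

  -- W = span(w) is a linear realization of U_{r,n}: w is linearly independent
  -- (so dim W = r) and for every r-subset B (given as an injection ι : Fin r → Fin n)
  -- the coordinate projection W → k^B, x ↦ x ∘ ι, is bijective.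
  IsUniformRealization : ∀ {r n} → (Fin r → Fin n → Carrier) → Set (c ⊔ ℓ)
  IsUniformRealization {r} {n} w =
    LinIndep w ×
    (∀ (ι : Fin r → Fin n) → Injective _≡_ _≡_ ι →
       (∀ x x′ → InSpan w x → InSpan w x′ →
          (∀ j → x (ι j) ≈ x′ (ι j)) → ∀ i → x i ≈ x′ i)
     × (∀ (z : Fin r → Carrier) →
          Σ (Fin n → Carrier) λ x → InSpan w x × (∀ j → x (ι j) ≈ z j)))

  -- Polynomial ring k[x₁,…,xₙ,y₁,…,yₙ]: finite lists of terms (coefficient, monomial),
  -- a monomial being a pair of exponent vectors; equality = equality of all coefficients.
  Mono : ℕ → Set
  Mono n = Vec ℕ n × Vec ℕ n

  Poly : ℕ → Set c
  Poly n = List (Carrier × Mono n)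

  coeff : ∀ {n} → Poly n → Mono n → Carrier
  coeff [] ν = 0#
  coeff ((a , (μ₁ , μ₂)) ∷ p) (ν₁ , ν₂) with ≡-dec ℕ._≟_ μ₁ ν₁ | ≡-dec ℕ._≟_ μ₂ ν₂
  ... | yes _ | yes _ = a + coeff p (ν₁ , ν₂)
  ... | _     | _     = coeff p (ν₁ , ν₂)

  _≈P_ : ∀ {n} → Poly n → Poly n → Set ℓ
  p ≈P q = ∀ ν → coeff p ν ≈ coeff q ν

  _+P_ : ∀ {n} → Poly n → Poly n → Poly n
  p +P q = Data.List._++_ p q

  _*P_ : ∀ {n} → Poly n → Poly n → Poly n
  p *P q = concatMap (λ { (a , (μ₁ , μ₂)) →
             map (λ { (b , (ν₁ , ν₂)) →
               (a * b , (zipWith ℕ._+_ μ₁ ν₁ , zipWith ℕ._+_ μ₂ ν₂)) }) q }) p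

  oneP : ∀ {n} → Poly n
  oneP {n} = (1# , (replicate n 0 , replicate n 0)) ∷ []

  unitExp : ∀ {n} → Fin n → Vec ℕ n
  unitExp i = tabulate (λ j → Data.Bool.if Relation.Nullary.Decidable.⌊ i ≟F j ⌋ then 1 else 0)
    where import Data.Bool; import Relation.Nullary.Decidable

  -- the variables x_i (images f_i in k[W]) and y_i (images g_i in k[W^⊥])
  X : ∀ {n} → Fin n → Poly n
  X {n} i = (1# , (unitExp i , replicate n 0)) ∷ []

  Y : ∀ {n} → Fin n → Poly n
  Y {n} i = (1# , (replicate n 0 , unitExp i)) ∷ []

  linX : ∀ {n} → (Fin n → Carrier) → Poly n
  linX {n} v = Data.List.tabulate (λ i → (v i , (unitExp i , replicate n 0)))

  linY : ∀ {n} → (Fin n → Carrier) → Poly n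
  linY {n} v = Data.List.tabulate (λ i → (v i , (replicate n 0 , unitExp i)))

  prodP : ∀ {m n} → (Fin m → Poly n) → Poly n
  prodP {ℕ.zero} p = oneP
  prodP {ℕ.suc m} p = p zero *P prodP (λ i → p (suc i))

  sumP : ∀ {n} → List (Poly n) → Poly n
  sumP = foldr _+P_ []

  -- S = k[W] ⊗ k[W^⊥] = k[x,y] / (linear forms in x vanishing on W,
  --                               linear forms in y vanishing on W^⊥).
  -- Σ cᵢxᵢ vanishes on W iff c ∈ W^⊥; Σ dᵢyᵢ vanishes on W^⊥ iff d ∈ (W^⊥)^⊥.
  -- Generators of the preimage in k[x,y] of the ideal of pairs 𝔞 = (f₁g₁,…,fₙgₙ) ⊆ S:
  PairsGen : ∀ {r n} → (Fin r → Fin n → Carrier) → Poly n → Set (c ⊔ ℓ)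
  PairsGen {n = n} w g =
      (Σ (Fin n) λ k → g ≡ X k *P Y k)
    ⊎ (Σ (Fin n → Carrier) λ v → Perp w v × g ≡ linX v)
    ⊎ (Σ (Fin n → Carrier) λ v → PerpPerp w v × g ≡ linY v)

  InIdeal : ∀ {n} {a} → (Poly n → Set a) → Poly n → Set (c ⊔ ℓ ⊔ a)
  InIdeal {n} Gen p = Σ (List (Poly n × Poly n)) λ l →
    All (λ hg → Gen (Data.Product.proj₂ hg)) l ×
    (p ≈P sumP (map (λ hg → Data.Product.proj₁ hg *P Data.Product.proj₂ hg) l))

  InPairIdeal : ∀ {r n} → (Fin r → Fin n → Carrier) → Poly n → Set (c ⊔ ℓ)
  InPairIdeal w p = InIdeal (PairsGen w) p

-- Write g_I for the product g_{i_1}⋯g_{i_r}. If a occurs among the i_j, then g_I f_a is a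
-- multiple of the generator f_a g_a. If the i_j are distinct they form a basis B of U_{r,n},
-- and the fundamental circuit of a with respect to B is a vector v ∈ W^⊥ with v_a = 1 and
-- support in B ∪ {a}; the linear form Σ v_k f_k is zero in S, so g_I f_a is a combination of
-- the g_I f_k with k ∈ B, which are in 𝔞 by the first case. If some index b is repeated,
-- complete {i_1,…,i_r} to a basis (linear independence forces r ≤ n) and take x ∈ W with
-- x_b = 1 vanishing on the other basis elements; Σ x_k g_k is zero in S, so one factor g_b of
-- g_I may be replaced by the g_k with k outside {i_1,…,i_r}. Each replacement covers a new
-- index, so induction on the number of uncovered indices concludes.

module Submission where

open import Defs
open import Level using (Level; _⊔_)
open import Algebra.Bundles using (Semiring; CommutativeRing)
open import Data.Nat as ℕ using (ℕ; zero; suc)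
import Data.Nat.Properties as ℕ
open import Data.Fin using (Fin; zero; suc; punchIn)
import Data.Fin.Properties as Fin
open import Data.Vec as Vec using (Vec; []; _∷_; zipWith; replicate)
import Data.Vec.Properties as Vec
open import Data.Vec.Functional using (removeAt; insertAt; updateAt)
open import Data.Vec.Functional.Properties using (insertAt-lookup; insertAt-punchIn; updateAt-updates; updateAt-minimal)
open import Data.List as List using (List; []; _∷_; _++_; map)
import Data.List.Properties as List
open import Data.Product using (Σ; _×_; _,_; proj₁; proj₂; ∃)
import Data.Product.Properties as Product
open import Data.Empty using (⊥-elim)
open import Data.Sum using (_⊎_; inj₁; inj₂)
open import Function using (_∘_; _∘′_)
open import Function.Definitions using (Injective)
open import Relation.Nullary using (¬_; Dec; yes; no)
open import Relation.Binary.Definitions using (DecidableEquality)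
open import Relation.Binary.Structures using (IsEquivalence)
open import Relation.Binary.Bundles using (Setoid)
open import Relation.Binary.PropositionalEquality as ≡ using (_≡_; _≢_)

module ListSum {c ℓ : Level} (R : Semiring c ℓ) where
  open Semiring R
  open import Relation.Binary.Reasoning.Setoid setoid
  open import Algebra.Properties.CommutativeSemigroup +-commutativeSemigroup using (x∙yz≈y∙xz)

  private variable
    a b : Level
    A : Set a
    B : Set b

  sumL : (A → Carrier) → List A → Carrier
  sumL f = List.foldr (λ x s → f x + s) 0#

  sumL-cong : ∀ {f g : A → Carrier} xs → (∀ x → f x ≈ g x) → sumL f xs ≈ sumL g xs
  sumL-cong []       f≈g = refl
  sumL-cong (x ∷ xs) f≈g = +-cong (f≈g x) (sumL-cong xs f≈g)

  sumL-zero : ∀ {f : A → Carrier} xs → (∀ x → f x ≈ 0#) → sumL f xs ≈ 0#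
  sumL-zero []       f≈0 = refl
  sumL-zero (x ∷ xs) f≈0 = trans (+-cong (f≈0 x) (sumL-zero xs f≈0)) (+-identityˡ 0#)

  sumL-++ : ∀ (f : A → Carrier) xs ys → sumL f (xs ++ ys) ≈ sumL f xs + sumL f ys
  sumL-++ f []       ys = sym (+-identityˡ _)
  sumL-++ f (x ∷ xs) ys = trans (+-congˡ (sumL-++ f xs ys)) (sym (+-assoc _ _ _))

  sumL-map : ∀ (f : B → Carrier) (g : A → B) xs → sumL f (map g xs) ≈ sumL (f ∘′ g) xs
  sumL-map f g []       = refl
  sumL-map f g (x ∷ xs) = +-congˡ (sumL-map f g xs)

  sumL-distrib-+ : ∀ (f g : A → Carrier) xs → sumL (λ x → f x + g x) xs ≈ sumL f xs + sumL g xs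
  sumL-distrib-+ f g []       = sym (+-identityˡ 0#)
  sumL-distrib-+ f g (x ∷ xs) = begin
    (f x + g x) + sumL (λ x → f x + g x) xs ≈⟨ +-congˡ (sumL-distrib-+ f g xs) ⟩
    (f x + g x) + (sumL f xs + sumL g xs)   ≈⟨ +-assoc _ _ _ ⟩
    f x + (g x + (sumL f xs + sumL g xs))   ≈⟨ +-congˡ (x∙yz≈y∙xz _ _ _) ⟩
    f x + (sumL f xs + (g x + sumL g xs))   ≈⟨ +-assoc _ _ _ ⟨
    (f x + sumL f xs) + (g x + sumL g xs)   ∎

  *-distribˡ-sumL : ∀ x (f : A → Carrier) xs → x * sumL f xs ≈ sumL (λ y → x * f y) xs
  *-distribˡ-sumL x f []       = zeroʳ x
  *-distribˡ-sumL x f (y ∷ ys) = trans (distribˡ x _ _) (+-congˡ (*-distribˡ-sumL x f ys))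

  sumL-comm : ∀ (f : A → B → Carrier) xs ys →
    sumL (λ x → sumL (f x) ys) xs ≈ sumL (λ y → sumL (λ x → f x y) xs) ys
  sumL-comm f []       ys = sym (sumL-zero ys (λ _ → refl))
  sumL-comm f (x ∷ xs) ys = begin
    sumL (f x) ys + sumL (λ x → sumL (f x) ys) xs         ≈⟨ +-congˡ (sumL-comm f xs ys) ⟩
    sumL (f x) ys + sumL (λ y → sumL (λ x → f x y) xs) ys ≈⟨ sumL-distrib-+ (f x) _ ys ⟨
    sumL (λ y → f x y + sumL (λ x → f x y) xs) ys          ∎

module FinSum {c ℓ : Level} (R : CommutativeRing c ℓ) where
  open CommutativeRing R hiding (zero)
  open import Relation.Binary.Reasoning.Setoid setoid
  open import Algebra.Properties.Semiring.Sum semiring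
    using (sum; sum-cong-≋; sum-remove; sum-replicate-zero; ∑-comm; *-distribˡ-sum)
  open import Algebra.Properties.Ring ring using (-1*x≈-x)
  open import Algebra.Properties.CommutativeSemigroup *-commutativeSemigroup using (x∙yz≈y∙xz)

  sum-zero : ∀ {m} (f : Fin m → Carrier) → (∀ k → f k ≈ 0#) → sum f ≈ 0#
  sum-zero {m} f f≈0 = trans (sum-cong-≋ f≈0) (sum-replicate-zero m)

  sum-neg : ∀ {m} (f : Fin m → Carrier) → sum (λ k → - f k) ≈ - sum f
  sum-neg f = begin
    sum (λ k → - f k)      ≈⟨ sum-cong-≋ (λ k → sym (-1*x≈-x (f k))) ⟩
    sum (λ k → - 1# * f k) ≈⟨ *-distribˡ-sum (- 1#) f ⟨
    - 1# * sum f           ≈⟨ -1*x≈-x (sum f) ⟩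
    - sum f                ∎

  δ : ∀ {m} → Fin m → Fin m → Carrier
  δ j k with j Fin.≟ k
  ... | yes _ = 1#
  ... | no _  = 0#

  δ-≡ : ∀ {m} (j : Fin m) → δ j j ≈ 1#
  δ-≡ j with j Fin.≟ j
  ... | yes _  = refl
  ... | no j≢j = ⊥-elim (j≢j ≡.refl)

  δ-≢ : ∀ {m} {j k : Fin m} → j ≢ k → δ j k ≈ 0#
  δ-≢ {j = j} {k} j≢k with j Fin.≟ k
  ... | yes j≡k = ⊥-elim (j≢k j≡k)
  ... | no _    = refl

  sum-δ : ∀ {m} (f : Fin m → Carrier) (a : Fin m) → sum (λ k → f k * δ k a) ≈ f a
  sum-δ {suc m} f a = begin
    sum (λ k → f k * δ k a)                                      ≈⟨ sum-remove (λ k → f k * δ k a) ⟩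
    f a * δ a a + sum (λ j → f (punchIn a j) * δ (punchIn a j) a)
      ≈⟨ +-cong (trans (*-congˡ (δ-≡ a)) (*-identityʳ (f a)))
                (sum-zero _ (λ j → trans (*-congˡ (δ-≢ (Fin.punchInᵢ≢i a j))) (zeroʳ _))) ⟩
    f a + 0#                                                     ≈⟨ +-identityʳ (f a) ⟩
    f a                                                          ∎

  sum-δ-∘ : ∀ {m n} (ι : Fin m → Fin n) (coef : Fin m → Carrier) (x : Fin n → Carrier) →
    sum (λ k → x k * sum (λ j → coef j * δ k (ι j))) ≈ sum (λ j → coef j * x (ι j))
  sum-δ-∘ ι coef x = begin
    sum (λ k → x k * sum (λ j → coef j * δ k (ι j)))
      ≈⟨ sum-cong-≋ (λ k → *-distribˡ-sum (x k) (λ j → coef j * δ k (ι j))) ⟩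
    sum (λ k → sum (λ j → x k * (coef j * δ k (ι j))))
      ≈⟨ ∑-comm (λ k j → x k * (coef j * δ k (ι j))) ⟩
    sum (λ j → sum (λ k → x k * (coef j * δ k (ι j))))
      ≈⟨ sum-cong-≋ (λ j → sum-cong-≋ (λ k → x∙yz≈y∙xz (x k) (coef j) (δ k (ι j)))) ⟩
    sum (λ j → sum (λ k → coef j * (x k * δ k (ι j))))
      ≈⟨ sum-cong-≋ (λ j → *-distribˡ-sum (coef j) (λ k → x k * δ k (ι j))) ⟨
    sum (λ j → coef j * sum (λ k → x k * δ k (ι j)))
      ≈⟨ sum-cong-≋ (λ j → *-congˡ (sum-δ x (ι j))) ⟩
    sum (λ j → coef j * x (ι j)) ∎
module Monomials {n : ℕ} where
  infixl 7 _·ₘ_ _/ₘ_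

  _·ₘ_ : Vec ℕ n × Vec ℕ n → Vec ℕ n × Vec ℕ n → Vec ℕ n × Vec ℕ n
  (μ₁ , μ₂) ·ₘ (ν₁ , ν₂) = zipWith ℕ._+_ μ₁ ν₁ , zipWith ℕ._+_ μ₂ ν₂

  _/ₘ_ : Vec ℕ n × Vec ℕ n → Vec ℕ n × Vec ℕ n → Vec ℕ n × Vec ℕ n
  (μ₁ , μ₂) /ₘ (ν₁ , ν₂) = zipWith ℕ._∸_ μ₁ ν₁ , zipWith ℕ._∸_ μ₂ ν₂

  _≟ₘ_ : DecidableEquality (Vec ℕ n × Vec ℕ n)
  _≟ₘ_ = Product.≡-dec (Vec.≡-dec ℕ._≟_) (Vec.≡-dec ℕ._≟_)

  ·ₘ-comm : ∀ μ ν → μ ·ₘ ν ≡ ν ·ₘ μ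
  ·ₘ-comm (μ₁ , μ₂) (ν₁ , ν₂) =
    ≡.cong₂ _,_ (Vec.zipWith-comm ℕ.+-comm μ₁ ν₁) (Vec.zipWith-comm ℕ.+-comm μ₂ ν₂)

  ·ₘ-assoc : ∀ μ ν κ → (μ ·ₘ ν) ·ₘ κ ≡ μ ·ₘ (ν ·ₘ κ)
  ·ₘ-assoc (μ₁ , μ₂) (ν₁ , ν₂) (κ₁ , κ₂) =
    ≡.cong₂ _,_ (Vec.zipWith-assoc ℕ.+-assoc μ₁ ν₁ κ₁) (Vec.zipWith-assoc ℕ.+-assoc μ₂ ν₂ κ₂)

  ·ₘ-identityˡ : ∀ μ → (replicate n 0 , replicate n 0) ·ₘ μ ≡ μ
  ·ₘ-identityˡ (μ₁ , μ₂) =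
    ≡.cong₂ _,_ (Vec.zipWith-identityˡ ℕ.+-identityˡ μ₁) (Vec.zipWith-identityˡ ℕ.+-identityˡ μ₂)

  ·ₘ-/ₘ : ∀ μ ν → (μ ·ₘ ν) /ₘ μ ≡ ν
  ·ₘ-/ₘ (μ₁ , μ₂) (ν₁ , ν₂) = ≡.cong₂ _,_ (+∸ μ₁ ν₁) (+∸ μ₂ ν₂)
    where
      +∸ : ∀ {k} (u v : Vec ℕ k) → zipWith ℕ._∸_ (zipWith ℕ._+_ u v) u ≡ v
      +∸ [] [] = ≡.refl
      +∸ (x ∷ u) (y ∷ v) = ≡.cong₂ _∷_ (ℕ.m+n∸m≡n x y) (+∸ u v)

  ·ₘ-cancelˡ : ∀ μ {ν κ} → μ ·ₘ ν ≡ μ ·ₘ κ → ν ≡ κ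
  ·ₘ-cancelˡ μ {ν} {κ} eq =
    ≡.trans (≡.sym (·ₘ-/ₘ μ ν)) (≡.trans (≡.cong (_/ₘ μ) eq) (·ₘ-/ₘ μ κ))

  -- The only candidate quotient is ν ∸ μ.
  divides? : ∀ μ ν → Dec (∃ λ κ → μ ·ₘ κ ≡ ν)
  divides? μ ν with (μ ·ₘ (ν /ₘ μ)) ≟ₘ ν
  ... | yes eq = yes (ν /ₘ μ , eq)
  ... | no neq = no λ { (κ , ≡.refl) → neq (≡.cong (μ ·ₘ_) (·ₘ-/ₘ μ κ)) }

module Polynomials {c ℓ : Level} (F : Field c ℓ) where
  open Field F hiding (zero)
  open Monomials
  open ListSum semiring
  open import Relation.Binary.Reasoning.Setoid setoid

  Term : ℕ → Set c
  Term n = Carrier × Mono F n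

  module _ {n : ℕ} where
    infixl 7 _·ₜ_

    _·ₜ_ : Term n → Term n → Term n
    (a , μ) ·ₜ (b , ν) = a * b , μ ·ₘ ν

    coeffₜ : Term n → Mono F n → Carrier
    coeffₜ (a , μ) ν with μ ≟ₘ ν
    ... | yes _ = a
    ... | no _  = 0#

    coeffₜ-≡ : ∀ a μ → coeffₜ (a , μ) μ ≈ a
    coeffₜ-≡ a μ with μ ≟ₘ μ
    ... | yes _  = refl
    ... | no μ≢μ = ⊥-elim (μ≢μ ≡.refl)

    coeffₜ-≢ : ∀ a {μ ν} → μ ≢ ν → coeffₜ (a , μ) ν ≈ 0#
    coeffₜ-≢ a {μ} {ν} μ≢ν with μ ≟ₘ ν
    ... | yes μ≡ν = ⊥-elim (μ≢ν μ≡ν)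
    ... | no _    = refl

    coeffₜ-cong : ∀ {a b μ μ′} ν → a ≈ b → μ ≡ μ′ → coeffₜ (a , μ) ν ≈ coeffₜ (b , μ′) ν
    coeffₜ-cong {μ = μ} ν a≈b ≡.refl with μ ≟ₘ ν
    ... | yes _ = a≈b
    ... | no _  = refl

    coeffₜ-*ˡ : ∀ a b μ ν → coeffₜ (a * b , μ) ν ≈ a * coeffₜ (b , μ) ν
    coeffₜ-*ˡ a b μ ν with μ ≟ₘ ν
    ... | yes _ = refl
    ... | no _  = sym (zeroʳ a)

    coeff-∷ : ∀ t p ν → coeff F (t ∷ p) ν ≈ coeffₜ t ν + coeff F p ν
    coeff-∷ (a , (μ₁ , μ₂)) p (ν₁ , ν₂)
      with Vec.≡-dec ℕ._≟_ μ₁ ν₁ | Vec.≡-dec ℕ._≟_ μ₂ ν₂ | (μ₁ , μ₂) ≟ₘ (ν₁ , ν₂)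
    ... | yes _ | yes _ | yes _ = refl
    ... | yes e₁ | yes e₂ | no μ≢ν = ⊥-elim (μ≢ν (≡.cong₂ _,_ e₁ e₂))
    ... | yes _ | no e₂ | yes μ≡ν = ⊥-elim (e₂ (≡.cong proj₂ μ≡ν))
    ... | yes _ | no _ | no _ = sym (+-identityˡ _)
    ... | no e₁ | _ | yes μ≡ν = ⊥-elim (e₁ (≡.cong proj₁ μ≡ν))
    ... | no _ | _ | no _ = sym (+-identityˡ _)

    infix  4 _≈ₚ_
    infixl 6 _+ₚ_
    infixl 7 _*ₚ_

    -- Defs' _≈P_ wrapped in a record, so that Agda can infer the polynomials it relates.
    record _≈ₚ_ (p q : Poly F n) : Set ℓ where
      constructor mk≈ₚ
      field coeff-≈ : _≈P_ F p q
    open _≈ₚ_ public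

    _+ₚ_ : Poly F n → Poly F n → Poly F n
    _+ₚ_ = _+P_ F

    _*ₚ_ : Poly F n → Poly F n → Poly F n
    _*ₚ_ = _*P_ F

    constₚ : Carrier → Poly F n
    constₚ a = (a , (replicate n 0 , replicate n 0)) ∷ []

    coeff-sumL : ∀ (p : Poly F n) ν → coeff F p ν ≈ sumL (λ t → coeffₜ t ν) p
    coeff-sumL []      ν = refl
    coeff-sumL (t ∷ p) ν = trans (coeff-∷ t p ν) (+-congˡ (coeff-sumL p ν))

    coeff-+ₚ : ∀ (p q : Poly F n) ν → coeff F (p +ₚ q) ν ≈ coeff F p ν + coeff F q ν
    coeff-+ₚ p q ν = begin
      coeff F (p ++ q) ν                                      ≈⟨ coeff-sumL (p ++ q) ν ⟩
      sumL (λ t → coeffₜ t ν) (p ++ q)                        ≈⟨ sumL-++ _ p q ⟩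
      sumL (λ t → coeffₜ t ν) p + sumL (λ t → coeffₜ t ν) q   ≈⟨ sym (+-cong (coeff-sumL p ν) (coeff-sumL q ν)) ⟩
      coeff F p ν + coeff F q ν                               ∎

    sumL-*ₚ : ∀ (h : Term n → Carrier) (p q : Poly F n) →
      sumL h (p *ₚ q) ≈ sumL (λ t → sumL (λ s → h (t ·ₜ s)) q) p
    sumL-*ₚ h []      q = refl
    sumL-*ₚ h (t ∷ p) q = trans (sumL-++ h (map (t ·ₜ_) q) (p *ₚ q))
                                (+-cong (sumL-map h (t ·ₜ_) q) (sumL-*ₚ h p q))

    coeff-*ₚ : ∀ (p q : Poly F n) ν → coeff F (p *ₚ q) ν ≈ sumL (λ t → sumL (λ s → coeffₜ (t ·ₜ s) ν) q) p
    coeff-*ₚ p q ν = trans (coeff-sumL (p *ₚ q) ν) (sumL-*ₚ (λ t → coeffₜ t ν) p q)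

    sumL-coeffₜ-·ₜ-divisible : ∀ a μ {κ ν} → μ ·ₘ κ ≡ ν → ∀ (q : Poly F n) →
      sumL (λ s → coeffₜ ((a , μ) ·ₜ s) ν) q ≈ a * coeff F q κ
    sumL-coeffₜ-·ₜ-divisible a μ {κ} {ν} μκ≡ν q = begin
      sumL (λ s → coeffₜ ((a , μ) ·ₜ s) ν) q ≈⟨ sumL-cong q shift ⟩
      sumL (λ s → a * coeffₜ s κ) q         ≈⟨ sym (*-distribˡ-sumL a _ q) ⟩
      a * sumL (λ s → coeffₜ s κ) q         ≈⟨ *-congˡ (sym (coeff-sumL q κ)) ⟩
      a * coeff F q κ                       ∎
      where
        shift : ∀ s → coeffₜ ((a , μ) ·ₜ s) ν ≈ a * coeffₜ s κ
        shift (b , λ′) with λ′ ≟ₘ κ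
        ... | yes ≡.refl = trans (coeffₜ-cong ν refl μκ≡ν) (coeffₜ-≡ (a * b) ν)
        ... | no λ′≢κ = trans (coeffₜ-≢ (a * b) (λ eq → λ′≢κ (·ₘ-cancelˡ μ (≡.trans eq (≡.sym μκ≡ν)))))
                              (sym (zeroʳ a))

    sumL-coeffₜ-·ₜ-indivisible : ∀ a μ {ν} → ¬ (∃ λ κ → μ ·ₘ κ ≡ ν) → ∀ (q : Poly F n) →
      sumL (λ s → coeffₜ ((a , μ) ·ₜ s) ν) q ≈ 0#
    sumL-coeffₜ-·ₜ-indivisible a μ ∤ν q = sumL-zero q (λ (b , λ′) → coeffₜ-≢ (a * b) (λ eq → ∤ν (λ′ , eq)))

    coeffₜ-·ₜ-comm : ∀ (t s : Term n) ν → coeffₜ (t ·ₜ s) ν ≈ coeffₜ (s ·ₜ t) ν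
    coeffₜ-·ₜ-comm (a , μ) (b , ν) κ = coeffₜ-cong κ (*-comm a b) (·ₘ-comm μ ν)

    coeffₜ-·ₜ-assoc : ∀ (t s u : Term n) ν → coeffₜ ((t ·ₜ s) ·ₜ u) ν ≈ coeffₜ (t ·ₜ (s ·ₜ u)) ν
    coeffₜ-·ₜ-assoc (a , μ) (b , ν) (d , κ) λ′ = coeffₜ-cong λ′ (*-assoc a b d) (·ₘ-assoc μ ν κ)

    coeff-constₚ-*ₚ : ∀ a (q : Poly F n) ν → coeff F (constₚ a *ₚ q) ν ≈ a * coeff F q ν
    coeff-constₚ-*ₚ a q ν = begin
      coeff F (constₚ a *ₚ q) ν                                ≈⟨ coeff-*ₚ (constₚ a) q ν ⟩
      sumL (λ s → coeffₜ ((a , 𝟙) ·ₜ s) ν) q + 0#               ≈⟨ +-identityʳ _ ⟩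
      sumL (λ s → coeffₜ ((a , 𝟙) ·ₜ s) ν) q                    ≈⟨ sumL-coeffₜ-·ₜ-divisible a 𝟙 (·ₘ-identityˡ ν) q ⟩
      a * coeff F q ν                                          ∎
      where 𝟙 = (replicate n 0 , replicate n 0)

    *ₚ-congˡ : ∀ (p : Poly F n) {q q′} → q ≈ₚ q′ → p *ₚ q ≈ₚ p *ₚ q′
    *ₚ-congˡ p {q} {q′} q≈q′ = mk≈ₚ λ ν → begin
      coeff F (p *ₚ q) ν                                     ≈⟨ coeff-*ₚ p q ν ⟩
      sumL (λ t → sumL (λ s → coeffₜ (t ·ₜ s) ν) q) p        ≈⟨ sumL-cong p (inner ν) ⟩
      sumL (λ t → sumL (λ s → coeffₜ (t ·ₜ s) ν) q′) p       ≈⟨ sym (coeff-*ₚ p q′ ν) ⟩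
      coeff F (p *ₚ q′) ν                                    ∎
      where
        inner : ∀ ν t → sumL (λ s → coeffₜ (t ·ₜ s) ν) q ≈ sumL (λ s → coeffₜ (t ·ₜ s) ν) q′
        inner ν (a , μ) with divides? μ ν
        ... | yes (κ , μκ≡ν) = trans (sumL-coeffₜ-·ₜ-divisible a μ μκ≡ν q)
                                 (trans (*-congˡ (coeff-≈ q≈q′ κ)) (sym (sumL-coeffₜ-·ₜ-divisible a μ μκ≡ν q′)))
        ... | no ∤ν = trans (sumL-coeffₜ-·ₜ-indivisible a μ ∤ν q) (sym (sumL-coeffₜ-·ₜ-indivisible a μ ∤ν q′))

    *ₚ-comm : ∀ (p q : Poly F n) → p *ₚ q ≈ₚ q *ₚ p
    *ₚ-comm p q = mk≈ₚ λ ν → begin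
      coeff F (p *ₚ q) ν                                ≈⟨ coeff-*ₚ p q ν ⟩
      sumL (λ t → sumL (λ s → coeffₜ (t ·ₜ s) ν) q) p   ≈⟨ sumL-comm (λ t s → coeffₜ (t ·ₜ s) ν) p q ⟩
      sumL (λ s → sumL (λ t → coeffₜ (t ·ₜ s) ν) p) q   ≈⟨ sumL-cong q (λ s → sumL-cong p (λ t → coeffₜ-·ₜ-comm t s ν)) ⟩
      sumL (λ s → sumL (λ t → coeffₜ (s ·ₜ t) ν) p) q   ≈⟨ sym (coeff-*ₚ q p ν) ⟩
      coeff F (q *ₚ p) ν                                ∎

    *ₚ-assoc : ∀ (p q r : Poly F n) → (p *ₚ q) *ₚ r ≈ₚ p *ₚ (q *ₚ r)
    *ₚ-assoc p q r = mk≈ₚ λ ν → begin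
      coeff F ((p *ₚ q) *ₚ r) ν
        ≈⟨ coeff-*ₚ (p *ₚ q) r ν ⟩
      sumL (λ v → sumL (λ u → coeffₜ (v ·ₜ u) ν) r) (p *ₚ q)
        ≈⟨ sumL-*ₚ (λ v → sumL (λ u → coeffₜ (v ·ₜ u) ν) r) p q ⟩
      sumL (λ t → sumL (λ s → sumL (λ u → coeffₜ ((t ·ₜ s) ·ₜ u) ν) r) q) p
        ≈⟨ sumL-cong p (λ t → sumL-cong q (λ s → sumL-cong r (λ u → coeffₜ-·ₜ-assoc t s u ν))) ⟩
      sumL (λ t → sumL (λ s → sumL (λ u → coeffₜ (t ·ₜ (s ·ₜ u)) ν) r) q) p
        ≈⟨ sumL-cong p (λ t → sym (sumL-*ₚ (λ v → coeffₜ (t ·ₜ v) ν) q r)) ⟩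
      sumL (λ t → sumL (λ v → coeffₜ (t ·ₜ v) ν) (q *ₚ r)) p
        ≈⟨ sym (coeff-*ₚ p (q *ₚ r) ν) ⟩
      coeff F (p *ₚ (q *ₚ r)) ν ∎

    *ₚ-distribˡ-+ₚ : ∀ (p q r : Poly F n) → p *ₚ (q +ₚ r) ≈ₚ p *ₚ q +ₚ p *ₚ r
    *ₚ-distribˡ-+ₚ p q r = mk≈ₚ λ ν → begin
      coeff F (p *ₚ (q +ₚ r)) ν
        ≈⟨ coeff-*ₚ p (q +ₚ r) ν ⟩
      sumL (λ t → sumL (λ s → coeffₜ (t ·ₜ s) ν) (q ++ r)) p
        ≈⟨ sumL-cong p (λ t → sumL-++ (λ s → coeffₜ (t ·ₜ s) ν) q r) ⟩
      sumL (λ t → sumL (λ s → coeffₜ (t ·ₜ s) ν) q + sumL (λ s → coeffₜ (t ·ₜ s) ν) r) p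
        ≈⟨ sumL-distrib-+ _ _ p ⟩
      sumL (λ t → sumL (λ s → coeffₜ (t ·ₜ s) ν) q) p + sumL (λ t → sumL (λ s → coeffₜ (t ·ₜ s) ν) r) p
        ≈⟨ sym (+-cong (coeff-*ₚ p q ν) (coeff-*ₚ p r ν)) ⟩
      coeff F (p *ₚ q) ν + coeff F (p *ₚ r) ν
        ≈⟨ sym (coeff-+ₚ (p *ₚ q) (p *ₚ r) ν) ⟩
      coeff F (p *ₚ q +ₚ p *ₚ r) ν ∎

    -ₚ_ : Poly F n → Poly F n
    -ₚ p = constₚ (- 1#) *ₚ p

    coeff--ₚ : ∀ p ν → coeff F (-ₚ p) ν ≈ - coeff F p ν
    coeff--ₚ p ν = trans (coeff-constₚ-*ₚ (- 1#) p ν) (-1*x≈-x _)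
      where open import Algebra.Properties.Ring ring using (-1*x≈-x)

    ≈ₚ-isEquivalence : IsEquivalence _≈ₚ_
    ≈ₚ-isEquivalence = record
      { refl  = mk≈ₚ λ ν → refl
      ; sym   = λ p≈q → mk≈ₚ λ ν → sym (coeff-≈ p≈q ν)
      ; trans = λ p≈q q≈r → mk≈ₚ λ ν → trans (coeff-≈ p≈q ν) (coeff-≈ q≈r ν)
      }

    ≈ₚ-setoid : Setoid c ℓ
    ≈ₚ-setoid = record { isEquivalence = ≈ₚ-isEquivalence }

    ≡⇒≈ₚ : ∀ {p q} → p ≡ q → p ≈ₚ q
    ≡⇒≈ₚ ≡.refl = mk≈ₚ λ ν → refl

    +ₚ-cong : ∀ {p p′ q q′} → p ≈ₚ p′ → q ≈ₚ q′ → p +ₚ q ≈ₚ p′ +ₚ q′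
    +ₚ-cong {p} {p′} {q} {q′} p≈p′ q≈q′ = mk≈ₚ λ ν →
      trans (coeff-+ₚ p q ν) (trans (+-cong (coeff-≈ p≈p′ ν) (coeff-≈ q≈q′ ν)) (sym (coeff-+ₚ p′ q′ ν)))

    +ₚ-comm : ∀ p q → p +ₚ q ≈ₚ q +ₚ p
    +ₚ-comm p q = mk≈ₚ λ ν → trans (coeff-+ₚ p q ν) (trans (+-comm _ _) (sym (coeff-+ₚ q p ν)))

    -ₚ-cong : ∀ {p q} → p ≈ₚ q → -ₚ p ≈ₚ -ₚ q
    -ₚ-cong {p} {q} p≈q = mk≈ₚ λ ν → trans (coeff--ₚ p ν) (trans (-‿cong (coeff-≈ p≈q ν)) (sym (coeff--ₚ q ν)))

    -ₚ-inverseˡ : ∀ p → -ₚ p +ₚ p ≈ₚ []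
    -ₚ-inverseˡ p = mk≈ₚ λ ν → trans (coeff-+ₚ (-ₚ p) p ν) (trans (+-congʳ (coeff--ₚ p ν)) (-‿inverseˡ _))

    *ₚ-cong : ∀ {p p′ q q′} → p ≈ₚ p′ → q ≈ₚ q′ → p *ₚ q ≈ₚ p′ *ₚ q′
    *ₚ-cong {p} {p′} {q} {q′} p≈p′ q≈q′ =
      ≈ₚ-trans (*ₚ-comm p q) (≈ₚ-trans (*ₚ-congˡ q p≈p′) (≈ₚ-trans (*ₚ-comm q p′) (*ₚ-congˡ p′ q≈q′)))
      where open IsEquivalence ≈ₚ-isEquivalence renaming (trans to ≈ₚ-trans)

    *ₚ-identityˡ : ∀ p → oneP F *ₚ p ≈ₚ p
    *ₚ-identityˡ p = mk≈ₚ λ ν → trans (coeff-constₚ-*ₚ 1# p ν) (*-identityˡ _)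

  polyRing : ℕ → CommutativeRing c ℓ
  polyRing n = record
    { Carrier = Poly F n
    ; _≈_ = _≈ₚ_
    ; _+_ = _+ₚ_
    ; _*_ = _*ₚ_
    ; -_ = -ₚ_
    ; 0# = []
    ; 1# = oneP F
    ; isCommutativeRing = record
      { isRing = record
        { +-isAbelianGroup = record
          { isGroup = record
            { isMonoid = record
              { isSemigroup = record
                { isMagma = record { isEquivalence = ≈ₚ-isEquivalence ; ∙-cong = +ₚ-cong }
                ; assoc = λ p q r → ≡⇒≈ₚ (List.++-assoc p q r)
                }
              ; identity = (λ p → ≡⇒≈ₚ ≡.refl) , (λ p → ≡⇒≈ₚ (List.++-identityʳ p))
              }
            ; inverse = comm∧invˡ⇒inv +ₚ-comm -ₚ-inverseˡ
            ; ⁻¹-cong = -ₚ-cong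
            }
          ; comm = +ₚ-comm
          }
        ; *-cong = *ₚ-cong
        ; *-assoc = *ₚ-assoc
        ; *-identity = comm∧idˡ⇒id *ₚ-comm *ₚ-identityˡ
        ; distrib = comm∧distrˡ⇒distr +ₚ-cong *ₚ-comm *ₚ-distribˡ-+ₚ
        }
      ; *-comm = *ₚ-comm
      }
    }
    where open import Algebra.Consequences.Setoid (≈ₚ-setoid {n})

  module _ {n : ℕ} where
    open import Algebra.Properties.Semiring.Sum (CommutativeRing.semiring (polyRing n)) using (sum)

    monomial : Mono F n → Poly F n
    monomial μ = (1# , μ) ∷ []

    coeff-constₚ-*ₚ-monomial : ∀ a μ ν → coeff F (constₚ a *ₚ monomial μ) ν ≈ coeffₜ (a , μ) ν
    coeff-constₚ-*ₚ-monomial a μ ν = begin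
      coeff F (constₚ a *ₚ monomial μ) ν  ≈⟨ coeff-constₚ-*ₚ a (monomial μ) ν ⟩
      a * coeff F (monomial μ) ν          ≈⟨ *-congˡ (coeff-∷ (1# , μ) [] ν) ⟩
      a * (coeffₜ (1# , μ) ν + 0#)        ≈⟨ *-congˡ (+-identityʳ _) ⟩
      a * coeffₜ (1# , μ) ν               ≈⟨ coeffₜ-*ˡ a 1# μ ν ⟨
      coeffₜ (a * 1# , μ) ν               ≈⟨ coeffₜ-cong {a = a * 1#} {b = a} {μ = μ} ν (*-identityʳ a) ≡.refl ⟩
      coeffₜ (a , μ) ν                    ∎

    tabulate≈sum : ∀ {m} (v : Fin m → Carrier) (μ : Fin m → Mono F n) →
      List.tabulate (λ k → (v k , μ k)) ≈ₚ sum (λ k → constₚ (v k) *ₚ monomial (μ k))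
    tabulate≈sum {zero}  v μ = mk≈ₚ λ ν → refl
    tabulate≈sum {suc m} v μ = mk≈ₚ λ ν → begin
      coeff F ((v zero , μ zero) ∷ List.tabulate (λ k → (v (suc k) , μ (suc k)))) ν
        ≈⟨ coeff-∷ (v zero , μ zero) _ ν ⟩
      coeffₜ (v zero , μ zero) ν + coeff F (List.tabulate (λ k → (v (suc k) , μ (suc k)))) ν
        ≈⟨ +-cong (sym (coeff-constₚ-*ₚ-monomial (v zero) (μ zero) ν)) (coeff-≈ (tabulate≈sum (v ∘ suc) (μ ∘ suc)) ν) ⟩
      coeff F (constₚ (v zero) *ₚ monomial (μ zero)) ν + coeff F (sum (λ k → constₚ (v (suc k)) *ₚ monomial (μ (suc k)))) ν
        ≈⟨ coeff-+ₚ (constₚ (v zero) *ₚ monomial (μ zero)) _ ν ⟨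
      coeff F (sum (λ k → constₚ (v k) *ₚ monomial (μ k))) ν ∎

    constₚ-cong : ∀ {a b} → a ≈ b → constₚ a ≈ₚ constₚ b
    constₚ-cong {a} {b} a≈b = mk≈ₚ λ ν →
      trans (coeff-∷ (a , 𝟙) [] ν) (trans (+-congʳ (coeffₜ-cong {a = a} {b = b} {μ = 𝟙} ν a≈b ≡.refl)) (sym (coeff-∷ (b , 𝟙) [] ν)))
      where 𝟙 = (replicate n 0 , replicate n 0)

    constₚ-0# : constₚ 0# ≈ₚ []
    constₚ-0# = mk≈ₚ λ ν → trans (coeff-∷ (0# , 𝟙) [] ν) (trans (+-identityʳ _) (zero-coefficient ν))
      where
        𝟙 = (replicate n 0 , replicate n 0)
        zero-coefficient : ∀ ν → coeffₜ (0# , 𝟙) ν ≈ 0#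
        zero-coefficient ν with 𝟙 ≟ₘ ν
        ... | yes _ = refl
        ... | no _  = refl

module GeneratedIdeal {c ℓ g : Level} (R : CommutativeRing c ℓ)
                      (Gen : CommutativeRing.Carrier R → Set g) where
  open CommutativeRing R hiding (zero)
  open import Relation.Binary.Reasoning.Setoid setoid
  open import Algebra.Properties.Semiring.Sum semiring using (sum; sum-remove)
  open import Algebra.Properties.Ring ring using (-1*x≈-x)
  open import Data.List.Relation.Unary.All as All using (All)
  import Data.List.Relation.Unary.All.Properties as All

  combination : List (Carrier × Carrier) → Carrier
  combination l = List.foldr _+_ 0# (map (λ hg → proj₁ hg * proj₂ hg) l)

  Member : Carrier → Set (c ⊔ ℓ ⊔ g)
  Member x = Σ (List (Carrier × Carrier)) λ l → All (λ hg → Gen (proj₂ hg)) l × x ≈ combination l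

  combination-++ : ∀ l l′ → combination (l ++ l′) ≈ combination l + combination l′
  combination-++ []       l′ = sym (+-identityˡ _)
  combination-++ (_ ∷ l) l′ = trans (+-congˡ (combination-++ l l′)) (sym (+-assoc _ _ _))

  *-distribˡ-combination : ∀ x l →
    x * combination l ≈ combination (map (λ hg → x * proj₁ hg , proj₂ hg) l)
  *-distribˡ-combination x []            = zeroʳ x
  *-distribˡ-combination x ((h , e) ∷ l) = begin
    x * (h * e + combination l)        ≈⟨ distribˡ x _ _ ⟩
    x * (h * e) + x * combination l    ≈⟨ +-cong (sym (*-assoc x h e)) (*-distribˡ-combination x l) ⟩
    x * h * e + combination (map (λ hg → x * proj₁ hg , proj₂ hg) l) ∎

  ∈-resp-≈ : ∀ {x y} → x ≈ y → Member y → Member x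
  ∈-resp-≈ x≈y (l , gens , y≈l) = l , gens , trans x≈y y≈l

  0∈ : Member 0#
  0∈ = [] , All.[] , refl

  gen⇒∈ : ∀ {x} → Gen x → Member x
  gen⇒∈ {x} gx = (1# , x) ∷ [] , gx All.∷ All.[] , sym (trans (+-identityʳ _) (*-identityˡ x))

  +-closed : ∀ {x y} → Member x → Member y → Member (x + y)
  +-closed (l , gl , x≈l) (l′ , gl′ , y≈l′) =
    l ++ l′ , All.++⁺ gl gl′ , trans (+-cong x≈l y≈l′) (sym (combination-++ l l′))

  *-closedˡ : ∀ x {y} → Member y → Member (x * y)
  *-closedˡ x (l , gl , y≈l) =
    map (λ hg → x * proj₁ hg , proj₂ hg) l , All.map⁺ gl , trans (*-congˡ y≈l) (*-distribˡ-combination x l)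

  ∈-cancelʳ : ∀ {x y} → Member (x + y) → Member y → Member x
  ∈-cancelʳ {x} {y} x+y∈ y∈ = ∈-resp-≈ x≈ (+-closed x+y∈ (*-closedˡ (- 1#) y∈))
    where
      x≈ : x ≈ (x + y) + - 1# * y
      x≈ = begin
        x                  ≈⟨ sym (+-identityʳ x) ⟩
        x + 0#             ≈⟨ +-congˡ (sym (-‿inverseʳ y)) ⟩
        x + (y + - y)      ≈⟨ sym (+-assoc x y (- y)) ⟩
        (x + y) + - y      ≈⟨ +-congˡ (sym (-1*x≈-x y)) ⟩
        (x + y) + - 1# * y ∎

  sum-closed : ∀ {m} (f : Fin m → Carrier) → (∀ k → Member (f k)) → Member (sum f)
  sum-closed {zero}  f f∈ = 0∈
  sum-closed {suc m} f f∈ = +-closed (f∈ zero) (sum-closed (f ∘ suc) (f∈ ∘ suc))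

  isolate-∈ : ∀ {m} (coef z : Fin m → Carrier) (a : Fin m) → coef a ≈ 1# →
    (∀ k → k ≢ a → coef k ≈ 0# ⊎ Member (z k)) →
    Member (sum (λ k → coef k * z k)) → Member (z a)
  isolate-∈ {suc m} coef z a coefa≈1 others∈ sum∈ =
    ∈-resp-≈ (sym (trans (*-congʳ coefa≈1) (*-identityˡ (z a))))
      (∈-cancelʳ (∈-resp-≈ (sym (sum-remove (λ k → coef k * z k))) sum∈)
                 (sum-closed _ (λ j → term∈ (punchIn a j) (Fin.punchInᵢ≢i a j))))
    where
      term∈ : ∀ k → k ≢ a → Member (coef k * z k)
      term∈ k k≢a with others∈ k k≢a
      ... | inj₁ coefk≈0 = ∈-resp-≈ (trans (*-congʳ coefk≈0) (zeroˡ (z k))) 0∈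
      ... | inj₂ zk∈     = *-closedˡ (coef k) zk∈

¬¬-∀-Fin : ∀ {m p} {P : Fin m → Set p} → (∀ j → ¬ ¬ P j) → ¬ ¬ (∀ j → P j)
¬¬-∀-Fin {zero}  ¬¬P ¬∀P = ¬∀P (λ ())
¬¬-∀-Fin {suc m} ¬¬P ¬∀P =
  ¬¬P zero λ P₀ → ¬¬-∀-Fin (¬¬P ∘ suc) λ P₊ → ¬∀P λ { zero → P₀ ; (suc j) → P₊ j }

module LinearAlgebra {c ℓ : Level} (F : Field c ℓ) where
  open Field F hiding (zero)
  open FinSum commutativeRing
  open import Relation.Binary.Reasoning.Setoid setoid
  open import Algebra.Properties.Semiring.Sum semiring
    using (sum; sum-cong-≋; sum-remove; ∑-distrib-+; ∑-comm; *-distribˡ-sum; *-distribʳ-sum)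
  open import Algebra.Properties.Ring ring using (-‿distribˡ-*; -‿distribʳ-*; -0#≈0#)

  sumF≈sum : ∀ {m} (f : Fin m → Carrier) → sumF F f ≈ sum f
  sumF≈sum {zero}  f = refl
  sumF≈sum {suc m} f = +-congˡ (sumF≈sum (f ∘ suc))

  linIndep-tail : ∀ {r n} (w : Fin r → Fin (suc n) → Carrier) → (∀ j → w j zero ≈ 0#) →
    LinIndep F w → LinIndep F (λ j i → w j (suc i))
  linIndep-tail w w₀≈0 ind t tw≈0 = ind t λ
    { zero    → trans (sumF≈sum (λ j → t j * w j zero)) (sum-zero _ (λ j → trans (*-congˡ (w₀≈0 j)) (zeroʳ (t j))))
    ; (suc i) → tw≈0 i }

  sum-insertAt-eliminated : ∀ {r} (t : Fin r → Carrier) (j₀ : Fin (suc r)) (coef : Fin r → Carrier)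
    (u : Fin (suc r) → Carrier) →
    sum (λ k → insertAt t j₀ (sum (λ j → - (t j * coef j))) k * u k)
      ≈ sum (λ j → t j * (u (punchIn j₀ j) - coef j * u j₀))
  sum-insertAt-eliminated t j₀ coef u = begin
    sum (λ k → t′ k * u k)
      ≈⟨ sum-remove (λ k → t′ k * u k) ⟩
    t′ j₀ * u j₀ + sum (λ j → t′ (punchIn j₀ j) * u (punchIn j₀ j))
      ≈⟨ +-cong (*-congʳ (reflexive (insertAt-lookup t j₀ s₀)))
                (sum-cong-≋ (λ j → *-congʳ (reflexive (insertAt-punchIn t j₀ s₀ j)))) ⟩
    s₀ * u j₀ + sum (λ j → t j * u (punchIn j₀ j))
      ≈⟨ +-congʳ (*-distribʳ-sum (u j₀) (λ j → - (t j * coef j))) ⟩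
    sum (λ j → - (t j * coef j) * u j₀) + sum (λ j → t j * u (punchIn j₀ j))
      ≈⟨ ∑-distrib-+ (λ j → - (t j * coef j) * u j₀) (λ j → t j * u (punchIn j₀ j)) ⟨
    sum (λ j → - (t j * coef j) * u j₀ + t j * u (punchIn j₀ j))
      ≈⟨ sum-cong-≋ (λ j → eliminate (t j) (coef j) (u j₀) (u (punchIn j₀ j))) ⟩
    sum (λ j → t j * (u (punchIn j₀ j) - coef j * u j₀)) ∎
    where
      s₀ = sum (λ j → - (t j * coef j))
      t′ = insertAt t j₀ s₀
      eliminate : ∀ a b x y → - (a * b) * x + a * y ≈ a * (y - b * x)
      eliminate a b x y = begin
        - (a * b) * x + a * y     ≈⟨ +-comm _ _ ⟩
        a * y + - (a * b) * x     ≈⟨ +-congˡ (-‿distribˡ-* (a * b) x) ⟨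
        a * y + - (a * b * x)     ≈⟨ +-congˡ (-‿cong (*-assoc a b x)) ⟩
        a * y + - (a * (b * x))   ≈⟨ +-congˡ (-‿distribʳ-* a (b * x)) ⟩
        a * y + a * - (b * x)     ≈⟨ distribˡ a y (- (b * x)) ⟨
        a * (y - b * x)           ∎

  linIndep-eliminate : ∀ {r n} (w : Fin (suc r) → Fin (suc n) → Carrier) (j₀ : Fin (suc r)) β →
    w j₀ zero * β ≈ 1# → LinIndep F w →
    LinIndep F (λ j i → w (punchIn j₀ j) (suc i) - w (punchIn j₀ j) zero * β * w j₀ (suc i))
  linIndep-eliminate w j₀ β αβ≈1 ind t t·w′≈0 j =
    ≡.subst (_≈ 0#) (insertAt-punchIn t j₀ s₀ j) (ind (insertAt t j₀ s₀) t₀·w≈0 (punchIn j₀ j))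
    where
      coef : _ → Carrier
      coef j = w (punchIn j₀ j) zero * β
      s₀ = sum (λ j → - (t j * coef j))
      pivot-cancels : ∀ j → w (punchIn j₀ j) zero - coef j * w j₀ zero ≈ 0#
      pivot-cancels j = begin
        y - y * β * w j₀ zero     ≈⟨ +-congˡ (-‿cong (*-assoc y β _)) ⟩
        y - y * (β * w j₀ zero)   ≈⟨ +-congˡ (-‿cong (*-congˡ (trans (*-comm β _) αβ≈1))) ⟩
        y - y * 1#                ≈⟨ +-congˡ (-‿cong (*-identityʳ y)) ⟩
        y - y                     ≈⟨ -‿inverseʳ y ⟩
        0#                        ∎
        where y = w (punchIn j₀ j) zero
      t₀·w≈0 : ∀ i → sumF F (λ k → insertAt t j₀ s₀ k * w k i) ≈ 0#
      t₀·w≈0 i = trans (sumF≈sum (λ k → insertAt t j₀ s₀ k * w k i)) (trans (sum-insertAt-eliminated t j₀ coef (λ k → w k i)) (column i))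
        where
          column : ∀ i → sum (λ j → t j * (w (punchIn j₀ j) i - coef j * w j₀ i)) ≈ 0#
          column zero    = sum-zero _ (λ j → trans (*-congˡ (pivot-cancels j)) (zeroʳ (t j)))
          column (suc i) = trans (sym (sumF≈sum (λ j → t j * (w (punchIn j₀ j) (suc i) - coef j * w j₀ (suc i)))))
                                 (t·w′≈0 i)

  -- Gaussian elimination on the first coordinate. Since ≈ need not be decidable, whether the
  -- first column vanishes is decided only under ¬¬, which suffices because the goal is ⊥.
  ¬linIndep : ∀ {r n} → n ℕ.< r → (w : Fin r → Fin n → Carrier) → ¬ LinIndep F w
  ¬linIndep {suc r} {zero}  _            w ind = 1≉0 (ind (λ _ → 1#) (λ ()) zero)
  ¬linIndep {suc r} {suc n} (ℕ.s≤s n<r) w ind = ¬¬-∀-Fin pivot first-column-zero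
    where
      first-column-zero : ¬ (∀ j → w j zero ≈ 0#)
      first-column-zero w₀≈0 = ¬linIndep (ℕ.m<n⇒m<1+n n<r) (λ j i → w j (suc i)) (linIndep-tail w w₀≈0 ind)
      pivot : ∀ j → ¬ ¬ (w j zero ≈ 0#)
      pivot j wj≉0 with inverse (w j zero) wj≉0
      ... | β , αβ≈1 = ¬linIndep n<r _ (linIndep-eliminate w j β αβ≈1 ind)

  linIndep⇒≤ : ∀ {r n} (w : Fin r → Fin n → Carrier) → LinIndep F w → r ℕ.≤ n
  linIndep⇒≤ w ind = ℕ.≮⇒≥ (λ n<r → ¬linIndep n<r w ind)

  dot-comm : ∀ {n} (x y : Fin n → Carrier) → dot F x y ≈ dot F y x
  dot-comm x y = begin
    sumF F (λ i → x i * y i) ≈⟨ sumF≈sum (λ i → x i * y i) ⟩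
    sum (λ i → x i * y i)    ≈⟨ sum-cong-≋ (λ i → *-comm (x i) (y i)) ⟩
    sum (λ i → y i * x i)    ≈⟨ sumF≈sum (λ i → y i * x i) ⟨
    sumF F (λ i → y i * x i) ∎

  module _ {r n : ℕ} (w : Fin r → Fin n → Carrier) where

    span⊆perpPerp : ∀ x → InSpan F w x → PerpPerp F w x
    span⊆perpPerp x x∈ y y⊥ = trans (dot-comm y x) (y⊥ x x∈)

    span-combination : ∀ {m} (u : Fin m → Fin n → Carrier) → (∀ j → InSpan F w (u j)) →
      (coef : Fin m → Carrier) → InSpan F w (λ k → sum (λ j → coef j * u j k))
    span-combination u u∈ coef = (λ l → sum (λ j → coef j * t j l)) , λ k → begin
      sum (λ j → coef j * u j k)
        ≈⟨ sum-cong-≋ (λ j → *-congˡ (trans (proj₂ (u∈ j) k) (sumF≈sum (λ l → t j l * w l k)))) ⟩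
      sum (λ j → coef j * sum (λ l → t j l * w l k))
        ≈⟨ sum-cong-≋ (λ j → *-distribˡ-sum (coef j) (λ l → t j l * w l k)) ⟩
      sum (λ j → sum (λ l → coef j * (t j l * w l k)))
        ≈⟨ ∑-comm (λ j l → coef j * (t j l * w l k)) ⟩
      sum (λ l → sum (λ j → coef j * (t j l * w l k)))
        ≈⟨ sum-cong-≋ (λ l → trans (sum-cong-≋ (λ j → sym (*-assoc (coef j) (t j l) (w l k))))
                                   (sym (*-distribʳ-sum (w l k) (λ j → coef j * t j l)))) ⟩
      sum (λ l → sum (λ j → coef j * t j l) * w l k)
        ≈⟨ sumF≈sum (λ l → sum (λ j → coef j * t j l) * w l k) ⟨
      sumF F (λ l → sum (λ j → coef j * t j l) * w l k) ∎
      where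
        t : _ → Fin r → Carrier
        t j = proj₁ (u∈ j)

    module _ (uniform : IsUniformRealization F w) (ι : Fin r → Fin n) (ι-inj : Injective _≡_ _≡_ ι) where

      dual : Fin r → Fin n → Carrier
      dual j = proj₁ (proj₂ (proj₂ uniform ι ι-inj) (δ j))

      dual∈span : ∀ j → InSpan F w (dual j)
      dual∈span j = proj₁ (proj₂ (proj₂ (proj₂ uniform ι ι-inj) (δ j)))

      dual-ι : ∀ j j′ → dual j (ι j′) ≈ δ j j′
      dual-ι j = proj₂ (proj₂ (proj₂ (proj₂ uniform ι ι-inj) (δ j)))

      span-expand : ∀ x → InSpan F w x → ∀ k → x k ≈ sum (λ j → x (ι j) * dual j k)
      span-expand x x∈ = proj₁ (proj₂ uniform ι ι-inj) x _ x∈ (span-combination dual dual∈span (x ∘ ι)) λ j′ → begin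
        x (ι j′)                                ≈⟨ sum-δ (x ∘ ι) j′ ⟨
        sum (λ j → x (ι j) * δ j j′)            ≈⟨ sum-cong-≋ (λ j → *-congˡ (dual-ι j j′)) ⟨
        sum (λ j → x (ι j) * dual j (ι j′))     ∎

      -- v = e_a − Σ_j dual_j(a) e_{ι j}: pairing with x ∈ W gives x_a minus the expansion of x_a.
      fundamentalCircuit : ∀ a → (∀ j → ι j ≢ a) →
        Σ (Fin n → Carrier) λ v → Perp F w v × v a ≈ 1# × (∀ k → k ≢ a → (∀ j → ι j ≢ k) → v k ≈ 0#)
      fundamentalCircuit a a∉ι = v , v⊥ , va≈1 , vk≈0
        where
          basisPart : Fin n → Carrier
          basisPart k = sum (λ j → dual j a * δ k (ι j))
          v : Fin n → Carrier
          v k = δ k a - basisPart k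
          basisPart≈0 : ∀ k → (∀ j → ι j ≢ k) → basisPart k ≈ 0#
          basisPart≈0 k k∉ι = sum-zero _ (λ j → trans (*-congˡ (δ-≢ (λ k≡ιj → k∉ι j (≡.sym k≡ιj)))) (zeroʳ _))
          va≈1 : v a ≈ 1#
          va≈1 = trans (+-cong (δ-≡ a) (trans (-‿cong (basisPart≈0 a a∉ι)) -0#≈0#)) (+-identityʳ 1#)
          vk≈0 : ∀ k → k ≢ a → (∀ j → ι j ≢ k) → v k ≈ 0#
          vk≈0 k k≢a k∉ι = trans (+-cong (δ-≢ k≢a) (trans (-‿cong (basisPart≈0 k k∉ι)) -0#≈0#)) (+-identityʳ 0#)
          v⊥ : Perp F w v
          v⊥ x x∈ = begin
            sumF F (λ k → x k * v k)
              ≈⟨ sumF≈sum (λ k → x k * v k) ⟩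
            sum (λ k → x k * (δ k a - basisPart k))
              ≈⟨ sum-cong-≋ (λ k → trans (distribˡ (x k) _ _) (+-congˡ (sym (-‿distribʳ-* (x k) (basisPart k))))) ⟩
            sum (λ k → x k * δ k a + - (x k * basisPart k))
              ≈⟨ ∑-distrib-+ (λ k → x k * δ k a) (λ k → - (x k * basisPart k)) ⟩
            sum (λ k → x k * δ k a) + sum (λ k → - (x k * basisPart k))
              ≈⟨ +-cong (sum-δ x a) (sum-neg (λ k → x k * basisPart k)) ⟩
            x a - sum (λ k → x k * basisPart k)
              ≈⟨ +-congˡ (-‿cong (sum-δ-∘ ι (λ j → dual j a) x)) ⟩
            x a - sum (λ j → dual j a * x (ι j))
              ≈⟨ +-congˡ (-‿cong (trans (sum-cong-≋ (λ j → *-comm (dual j a) (x (ι j)))) (sym (span-expand x x∈ a)))) ⟩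
            x a - x a
              ≈⟨ -‿inverseʳ (x a) ⟩
            0# ∎

module IndexMaps where
  open import Algebra.Properties.CommutativeMonoid.Sum ℕ.+-0-commutativeMonoid using (sum; sum-remove)
  open import Data.Bool using (if_then_else_)
  open import Relation.Nullary using (does)
  open import Relation.Nullary.Decidable using (¬?; _×-dec_)

  InImage : ∀ {r n} → (Fin r → Fin n) → Fin n → Set
  InImage f k = ∃ λ j → f j ≡ k

  inImage? : ∀ {r n} (f : Fin r → Fin n) k → Dec (InImage f k)
  inImage? f k = Fin.any? (λ j → f j Fin.≟ k)

  nonSurjective : ∀ {r n} → r ℕ.< n → (ι : Fin r → Fin n) → ∃ λ k → ¬ InImage ι k
  nonSurjective {n = n} r<n ι with Fin.all? (inImage? ι)
  ... | no ¬surj = Fin.¬∀⟶∃¬ n _ (inImage? ι) ¬surj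
  ... | yes surj = ⊥-elim (ℕ.<⇒≱ r<n (Fin.injective⇒≤ preimage-injective))
    where
      preimage-injective : Injective _≡_ _≡_ (λ k → proj₁ (surj k))
      preimage-injective {k} {k′} eq =
        ≡.trans (≡.sym (proj₂ (surj k))) (≡.trans (≡.cong ι eq) (proj₂ (surj k′)))

  extendToInjection : ∀ {r n} → r ℕ.≤ n → (i : Fin r → Fin n) →
    Σ (Fin r → Fin n) λ ι → Injective _≡_ _≡_ ι × (∀ j → InImage ι (i j))
  extendToInjection {zero}  _    i = (λ ()) , (λ {}) , (λ ())
  extendToInjection {suc r} r<n i with extendToInjection (ℕ.<⇒≤ r<n) (i ∘ suc)
  ... | ι′ , ι′-inj , i⊆ι′ = ι , ι-inj , i⊆ι
    where
      new : Σ (Fin _) λ k → ¬ InImage ι′ k × (k ≡ i zero ⊎ InImage ι′ (i zero))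
      new with inImage? ι′ (i zero)
      ... | no  i₀∉ι′ = i zero , i₀∉ι′ , inj₁ ≡.refl
      ... | yes i₀∈ι′ = proj₁ (nonSurjective r<n ι′) , proj₂ (nonSurjective r<n ι′) , inj₂ i₀∈ι′
      ι : Fin (suc r) → Fin _
      ι zero    = proj₁ new
      ι (suc j) = ι′ j
      ι-inj : Injective _≡_ _≡_ ι
      ι-inj {zero}  {zero}  _  = ≡.refl
      ι-inj {zero}  {suc j} eq = ⊥-elim (proj₁ (proj₂ new) (j , ≡.sym eq))
      ι-inj {suc j} {zero}  eq = ⊥-elim (proj₁ (proj₂ new) (j , eq))
      ι-inj {suc j} {suc k} eq = ≡.cong suc (ι′-inj eq)
      i⊆ι : ∀ j → InImage ι (i j)
      i⊆ι zero with proj₂ (proj₂ new)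
      ... | inj₁ eq        = zero , eq
      ... | inj₂ (j , eq)  = suc j , eq
      i⊆ι (suc j) = suc (proj₁ (i⊆ι′ j)) , proj₂ (i⊆ι′ j)

  collision-or-injective : ∀ {r n} (i : Fin r → Fin n) →
    (∃ λ j₁ → ∃ λ j₂ → j₁ ≢ j₂ × i j₁ ≡ i j₂) ⊎ Injective _≡_ _≡_ i
  collision-or-injective i
    with Fin.any? (λ j₁ → Fin.any? (λ j₂ → ¬? (j₁ Fin.≟ j₂) ×-dec (i j₁ Fin.≟ i j₂)))
  ... | yes collision = inj₁ collision
  ... | no ¬collision = inj₂ i-inj
    where
      i-inj : Injective _≡_ _≡_ i
      i-inj {j₁} {j₂} eq with j₁ Fin.≟ j₂
      ... | yes j₁≡j₂ = j₁≡j₂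
      ... | no  j₁≢j₂ = ⊥-elim (¬collision (j₁ , j₂ , j₁≢j₂ , eq))

  sum-mono-≤ : ∀ {m} (f g : Fin m → ℕ) → (∀ k → f k ℕ.≤ g k) → sum f ℕ.≤ sum g
  sum-mono-≤ {zero}  f g f≤g = ℕ.z≤n
  sum-mono-≤ {suc m} f g f≤g = ℕ.+-mono-≤ (f≤g zero) (sum-mono-≤ (f ∘ suc) (g ∘ suc) (f≤g ∘ suc))

  #uncovered : ∀ {r n} → (Fin r → Fin n) → ℕ
  #uncovered i = sum (λ k → if does (inImage? i k) then 0 else 1)

  #uncovered-< : ∀ {r n} (i i′ : Fin r → Fin n) k → (∀ k′ → InImage i k′ → InImage i′ k′) →
    InImage i′ k → ¬ InImage i k → #uncovered i′ ℕ.< #uncovered i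
  #uncovered-< {n = suc _} i i′ k i⊆i′ k∈i′ k∉i = begin-strict
    sum (indicator i′)                                    ≡⟨ sum-remove (indicator i′) ⟩
    indicator i′ k ℕ.+ sum (removeAt (indicator i′) k)    <⟨ ℕ.+-mono-<-≤ strictly (sum-mono-≤ (removeAt (indicator i′) k) (removeAt (indicator i) k) (weak ∘ punchIn k)) ⟩
    indicator i k ℕ.+ sum (removeAt (indicator i) k)      ≡⟨ sum-remove (indicator i) ⟨
    sum (indicator i)                                     ∎
    where
      open ℕ.≤-Reasoning
      indicator : (Fin _ → Fin _) → Fin _ → ℕ
      indicator f k′ = if does (inImage? f k′) then 0 else 1
      weak : ∀ k′ → indicator i′ k′ ℕ.≤ indicator i k′
      weak k′ with inImage? i′ k′ | inImage? i k′
      ... | yes _ | _ = ℕ.z≤n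
      ... | no k′∉i′ | yes k′∈i = ⊥-elim (k′∉i′ (i⊆i′ k′ k′∈i))
      ... | no _ | no _ = ℕ.≤-refl
      strictly : indicator i′ k ℕ.< indicator i k
      strictly with inImage? i′ k | inImage? i k
      ... | yes _ | no _ = ℕ.s≤s ℕ.z≤n
      ... | no k∉i′ | _ = ⊥-elim (k∉i′ k∈i′)
      ... | yes _ | yes k∈i = ⊥-elim (k∉i k∈i)

  updateAt-collision-< : ∀ {r n} (i : Fin r → Fin n) {j₁ j₂} → j₁ ≢ j₂ → i j₁ ≡ i j₂ →
    ∀ {k} → ¬ InImage i k → #uncovered (updateAt i j₁ (λ _ → k)) ℕ.< #uncovered i
  updateAt-collision-< i {j₁} {j₂} j₁≢j₂ ij₁≡ij₂ {k} k∉i =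
    #uncovered-< i (updateAt i j₁ (λ _ → k)) k image-grows (j₁ , updateAt-updates j₁ i) k∉i
    where
      image-grows : ∀ k′ → InImage i k′ → InImage (updateAt i j₁ (λ _ → k)) k′
      image-grows _ (j , ≡.refl) with j Fin.≟ j₁
      ... | yes ≡.refl = j₂ , ≡.trans (updateAt-minimal j₂ j₁ i (j₁≢j₂ ∘ ≡.sym)) (≡.sym ij₁≡ij₂)
      ... | no  j≢j₁   = j , updateAt-minimal j j₁ i j≢j₁

module PairIdeal {c ℓ : Level} (F : Field c ℓ) {r n : ℕ} (w : Fin r → Fin n → Field.Carrier F)
                 (uniform : IsUniformRealization F w) where
  open Field F using () renaming (Carrier to 𝕜; _≈_ to _≈𝕜_; 1# to 1𝕜; 0# to 0𝕜)
  open Polynomials F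
  open FinSum (Field.commutativeRing F) using (δ; δ-≡; δ-≢)
  open LinearAlgebra F
  open IndexMaps
  open CommutativeRing (polyRing n) hiding (zero)
  open GeneratedIdeal (polyRing n) (PairsGen F w)
  open import Algebra.Properties.Semiring.Sum semiring using (sum; sum-cong-≋; *-distribˡ-sum)
  open import Algebra.Properties.CommutativeMonoid.Sum *-commutativeMonoid
    using () renaming (sum to product; sum-remove to product-remove; sum-cong-≗ to product-cong-≗)
  open import Algebra.Properties.CommutativeSemigroup *-commutativeSemigroup using (x∙yz≈y∙xz; xy∙z≈y∙zx; xy∙z≈yz∙x)
  open import Relation.Binary.Reasoning.Setoid setoid
  open import Induction.WellFounded using (module All)
  import Relation.Binary.Construct.On as On
  import Data.Nat.Induction as ℕ

  ∈⇒inPairIdeal : ∀ {p} → Member p → InPairIdeal F w p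
  ∈⇒inPairIdeal (l , gens , p≈l) = l , gens , coeff-≈ p≈l

  prodP≡product : ∀ {m} (f : Fin m → Poly F n) → prodP F f ≡ product f
  prodP≡product {zero}  f = ≡.refl
  prodP≡product {suc m} f = ≡.cong (f zero *_) (prodP≡product (f ∘ suc))

  yProduct : ∀ {m} → (Fin m → Fin n) → Poly F n
  yProduct i = prodP F (Y F ∘ i)

  yProduct-cong : ∀ {m} {i i′ : Fin m → Fin n} → (∀ j → i j ≡ i′ j) → yProduct i ≡ yProduct i′
  yProduct-cong {i = i} {i′} i≗i′ =
    ≡.trans (prodP≡product (Y F ∘ i)) (≡.trans (product-cong-≗ (≡.cong (Y F) ∘ i≗i′)) (≡.sym (prodP≡product (Y F ∘ i′))))

  yProduct-remove : ∀ {m} (i : Fin (suc m) → Fin n) j → yProduct i ≈ Y F (i j) * yProduct (removeAt i j)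
  yProduct-remove i j = begin
    yProduct i                                  ≡⟨ prodP≡product (Y F ∘ i) ⟩
    product (Y F ∘ i)                           ≈⟨ product-remove (Y F ∘ i) ⟩
    Y F (i j) * product (removeAt (Y F ∘ i) j)  ≡⟨ ≡.cong (Y F (i j) *_) (prodP≡product (Y F ∘ removeAt i j)) ⟨
    Y F (i j) * yProduct (removeAt i j)         ∎

  linX≈sum : ∀ v → linX F v ≈ sum (λ k → constₚ (v k) * X F k)
  linX≈sum v = tabulate≈sum v (λ k → unitExp F k , replicate n 0)

  linY≈sum : ∀ v → linY F v ≈ sum (λ k → constₚ (v k) * Y F k)
  linY≈sum v = tabulate≈sum v (λ k → replicate n 0 , unitExp F k)

  isolate-linear : (z : Fin n → Poly F n) (v : Fin n → 𝕜) (p : Poly F n) (a : Fin n) → v a ≈𝕜 1𝕜 →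
    (∀ k → k ≢ a → v k ≈𝕜 0𝕜 ⊎ Member (p * z k)) →
    Member (p * sum (λ k → constₚ (v k) * z k)) → Member (p * z a)
  isolate-linear z v p a va≈1 others∈ p·form∈ =
    isolate-∈ (constₚ ∘ v) (λ k → p * z k) a (constₚ-cong va≈1) others∈′ (∈-resp-≈ distribute p·form∈)
    where
      others∈′ : ∀ k → k ≢ a → constₚ (v k) ≈ 0# ⊎ Member (p * z k)
      others∈′ k k≢a with others∈ k k≢a
      ... | inj₁ vk≈0 = inj₁ (trans (constₚ-cong vk≈0) constₚ-0#)
      ... | inj₂ pzk∈ = inj₂ pzk∈
      distribute : sum (λ k → constₚ (v k) * (p * z k)) ≈ p * sum (λ k → constₚ (v k) * z k)
      distribute = sym (trans (*-distribˡ-sum p (λ k → constₚ (v k) * z k))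
                              (sum-cong-≋ (λ k → x∙yz≈y∙xz p (constₚ (v k)) (z k))))

  diagonal∈ : ∀ {m} (i : Fin m → Fin n) a j → i j ≡ a → Member (yProduct i * X F a)
  diagonal∈ {suc m} i a j ≡.refl =
    ∈-resp-≈ (trans (*-congʳ (yProduct-remove i j)) (xy∙z≈y∙zx (Y F a) (yProduct (removeAt i j)) (X F a)))
             (*-closedˡ (yProduct (removeAt i j)) (gen⇒∈ (inj₁ (a , ≡.refl))))

  injective∈ : (i : Fin r → Fin n) → Injective _≡_ _≡_ i → ∀ a → ¬ InImage i a →
    Member (yProduct i * X F a)
  injective∈ i i-inj a a∉i with fundamentalCircuit w uniform i i-inj a (λ j ij≡a → a∉i (j , ij≡a))
  ... | v , v⊥ , va≈1 , vk≈0 = isolate-linear (X F) v (yProduct i) a va≈1 others∈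
    (∈-resp-≈ (*-congˡ {yProduct i} (sym (linX≈sum v))) (*-closedˡ (yProduct i) (gen⇒∈ (inj₂ (inj₁ (v , v⊥ , ≡.refl))))))
    where
      others∈ : ∀ k → k ≢ a → v k ≈𝕜 0𝕜 ⊎ Member (yProduct i * X F k)
      others∈ k k≢a with inImage? i k
      ... | yes (j , ij≡k) = inj₂ (diagonal∈ i k j ij≡k)
      ... | no  k∉i        = inj₁ (vk≈0 k k≢a (λ j ij≡k → k∉i (j , ij≡k)))

  collision∈ : ∀ {m} (i : Fin m → Fin n) a (j₁ j₂ : Fin m) → j₁ ≢ j₂ → i j₁ ≡ i j₂ →
    (x : Fin n → 𝕜) → PerpPerp F w x → x (i j₁) ≈𝕜 1𝕜 → (∀ k → k ≢ i j₁ → InImage i k → x k ≈𝕜 0𝕜) →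
    (∀ (i′ : Fin m → Fin n) → #uncovered i′ ℕ.< #uncovered i → Member (yProduct i′ * X F a)) →
    Member (yProduct i * X F a)
  collision∈ {suc m} i a j₁ j₂ j₁≢j₂ ij₁≡ij₂ x x⊥⊥ xb≈1 xk≈0 smaller∈ =
    ∈-resp-≈ split (isolate-linear (Y F) x rest (i j₁) xb≈1 others∈
      (∈-resp-≈ (*-congˡ {rest} (sym (linY≈sum x))) (*-closedˡ rest (gen⇒∈ (inj₂ (inj₂ (x , x⊥⊥ , ≡.refl)))))))
    where
      rest = yProduct (removeAt i j₁) * X F a
      split : yProduct i * X F a ≈ rest * Y F (i j₁)
      split = trans (*-congʳ (yProduct-remove i j₁)) (xy∙z≈yz∙x (Y F (i j₁)) (yProduct (removeAt i j₁)) (X F a))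
      replaced : Fin n → Fin (suc m) → Fin n
      replaced k = updateAt i j₁ (λ _ → k)
      replaced-split : ∀ k → yProduct (replaced k) * X F a ≈ rest * Y F k
      replaced-split k = begin
        yProduct (replaced k) * X F a
          ≈⟨ *-congʳ (yProduct-remove (replaced k) j₁) ⟩
        Y F (replaced k j₁) * yProduct (removeAt (replaced k) j₁) * X F a
          ≡⟨ ≡.cong₂ (λ k′ g → Y F k′ * g * X F a) (updateAt-updates j₁ i)
               (yProduct-cong (λ j → updateAt-minimal (punchIn j₁ j) j₁ i (Fin.punchInᵢ≢i j₁ j))) ⟩
        Y F k * yProduct (removeAt i j₁) * X F a
          ≈⟨ xy∙z≈yz∙x (Y F k) (yProduct (removeAt i j₁)) (X F a) ⟩
        rest * Y F k ∎
      others∈ : ∀ k → k ≢ i j₁ → x k ≈𝕜 0𝕜 ⊎ Member (rest * Y F k)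
      others∈ k k≢b with inImage? i k
      ... | yes k∈i = inj₁ (xk≈0 k k≢b k∈i)
      ... | no  k∉i = inj₂ (∈-resp-≈ (sym (replaced-split k))
                              (smaller∈ (replaced k) (updateAt-collision-< i j₁≢j₂ ij₁≡ij₂ k∉i)))

  coordinateVector : (i : Fin r → Fin n) (j : Fin r) → Σ (Fin n → 𝕜) λ x →
    InSpan F w x × x (i j) ≈𝕜 1𝕜 × (∀ k → k ≢ i j → InImage i k → x k ≈𝕜 0𝕜)
  coordinateVector i j with extendToInjection (linIndep⇒≤ w (proj₁ uniform)) i
  ... | ι , ι-inj , i⊆ι with i⊆ι j
  ...   | l , ιl≡ij = x , dual∈span w uniform ι ι-inj l , x-ij≈1 , x-k≈0
    where
      x = dual w uniform ι ι-inj l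
      x-ι : ∀ l′ → x (ι l′) ≈𝕜 δ l l′
      x-ι = dual-ι w uniform ι ι-inj l
      x-ij≈1 : x (i j) ≈𝕜 1𝕜
      x-ij≈1 = ≡.subst (λ k → x k ≈𝕜 1𝕜) ιl≡ij (Field.trans F (x-ι l) (δ-≡ l))
      x-k≈0 : ∀ k → k ≢ i j → InImage i k → x k ≈𝕜 0𝕜
      x-k≈0 _ k≢ij (j′ , ≡.refl) with i⊆ι j′
      ... | l′ , ιl′≡ij′ = ≡.subst (λ k → x k ≈𝕜 0𝕜) ιl′≡ij′ (Field.trans F (x-ι l′) (δ-≢ l≢l′))
        where
          l≢l′ : l ≢ l′
          l≢l′ ≡.refl = k≢ij (≡.trans (≡.sym ιl′≡ij′) ιl≡ij)

  yProduct-X∈ : ∀ (i : Fin r → Fin n) a → Member (yProduct i * X F a)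
  yProduct-X∈ i a = All.wfRec (On.wellFounded (#uncovered {r} {n}) ℕ.<-wellFounded) _
                              (λ i → Member (yProduct i * X F a)) step i
    where
      step : ∀ i → (∀ {i′} → #uncovered i′ ℕ.< #uncovered i → Member (yProduct i′ * X F a)) →
             Member (yProduct i * X F a)
      step i smaller∈ with inImage? i a
      ... | yes (j , ij≡a) = diagonal∈ i a j ij≡a
      ... | no a∉i with collision-or-injective i
      ...   | inj₂ i-inj = injective∈ i i-inj a a∉i
      ...   | inj₁ (j₁ , j₂ , j₁≢j₂ , ij₁≡ij₂) with coordinateVector i j₁
      ...     | x , x∈ , xb≈1 , xk≈0 =
                collision∈ i a j₁ j₂ j₁≢j₂ ij₁≡ij₂ x (span⊆perpPerp w x x∈) xb≈1 xk≈0 (λ i′ → smaller∈)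

lemma3p23 : ∀ {c ℓ : Level} (F : Field c ℓ) (r n : ℕ)
    (w : Fin r → Fin n → Field.Carrier F) →
    IsUniformRealization F w →
    ∀ (i : Fin r → Fin n) (a : Fin n) →
    InPairIdeal F w (_*P_ F (prodP F (λ j → Y F (i j))) (X F a))
lemma3p23 F r n w uniform i a = ∈⇒inPairIdeal (yProduct-X∈ i a)
  where open PairIdeal F w uniform
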